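{- Let $\mu\in\{\rho^+,\rho^-,\pi^+,\pi^-,\mathfrak{4},\lambda,\mathsf{J}\}$. For all modal trees $\mathtt{T},\mathtt{S}$: if $\mathtt{T}\hookrightarrow^{\sigma}\circ\hookrightarrow^{\mu}\mathtt{S}$, then $\mathtt{T}\hookrightarrow^{\mu}\circ\hookrightarrow^{\sigma*}\mathtt{S}$.
   Context: Modal trees: recursively, pairs $\langle\Delta;\Gamma\rangle$ with $\Delta$ a finite list of propositional variables and $\Gamma$ a finite list of pairs $(\alpha,\mathtt{S})$, $\alpha<\omega$, $\mathtt{S}$ a modal tree. Positions: $\mathrm{Pos}(\langle\Delta;\varnothing\rangle)=\{\epsilon\}$; $\mathrm{Pos}(\langle\Delta;[(\alpha_1,\mathtt{S}_1),\dots,(\alpha_n,\mathtt{S}_n)]\rangle)=\{\epsilon\}\cup\bigcup_{i=1}^n\{i\mathbf{k}\mid\mathbf{k}\in\mathrm{Pos}(\mathtt{S}_i)\}$. Subtree: $\mathtt{T}|_\epsilon=\mathtt{T}$, $\mathtt{T}|_{i\mathbf{r}}=\mathtt{S}_i|_{\mathbf{r}}$. Replacement: $\mathtt{T}[\mathtt{S}]_\epsilon=\mathtt{S}$, $\mathtt{T}[\mathtt{S}]_{i\mathbf{r}}$ is $\mathtt{T}$ with its $i$-th child $\mathtt{S}_i$ replaced by $\mathtt{S}_i[\mathtt{S}]_{\mathbf{r}}$ (same edge label). List operations, for $0<i,j\le|\Gamma|$: $\#_i\Gamma$ is the $i$-th element; $\Gamma^{ -i}$ deletes it; $\Gamma^{+i}=(\#_i\Gamma)\frown\Gamma$;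 $\Gamma[x]_i$ replaces the $i$-th element by $x$; $\Gamma^{i\leftrightarrow j}$ swaps the $i$-th and $j$-th elements; similarly $\Delta^{ -n},\Delta^{+n}$. Rules: for a modal tree $\mathtt{T}$, $\mathbf{k}\in\mathrm{Pos}(\mathtt{T})$ with $\mathtt{T}|_\mathbf{k}=\langle\Delta;\Gamma\rangle$: ($\rho^+$) $\mathtt{T}\hookrightarrow^{\rho^+}\mathtt{T}[\langle\Delta^{+i};\Gamma\rangle]_\mathbf{k}$, $0<i\le|\Delta|$; ($\rho^-$) $\mathtt{T}\hookrightarrow^{\rho^- }\mathtt{T}[\langle\Delta^{ -i};\Gamma\rangle]_\mathbf{k}$; ($\sigma$) $\mathtt{T}\hookrightarrow^{\sigma}\mathtt{T}[\langle\Delta;\Gamma^{i\leftrightarrow j}\rangle]_\mathbf{k}$, $i\neq j$; ($\pi^+$) $\mathtt{T}\hookrightarrow^{\pi^+}\mathtt{T}[\langle\Delta;\Gamma^{+i}\rangle]_\mathbf{k}$; ($\pi^-$) $\mathtt{T}\hookrightarrow^{\pi^- }\mathtt{T}[\langle\Delta;\Gamma^{ -i}\rangle]_\mathbf{k}$; ($\mathfrak{4}$) if $\#_i\Gamma=(\beta,\langle\tilde\Delta;\tilde\Gamma\rangle)$ and $\#_j\tilde\Gamma=(\beta,\mathtt{S})$, then $\mathtt{T}\hookrightarrow^{\mathfrak{4}}\mathtt{T}[\langle\Delta;\Gamma[(\beta,\mathtt{S})]_i\rangle]_\mathbf{k}$; ($\lambda$) if $\#_i\Gamma=(\alpha,\mathtt{S})$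 and $\alpha>\beta$, then $\mathtt{T}\hookrightarrow^{\lambda}\mathtt{T}[\langle\Delta;\Gamma[(\beta,\mathtt{S})]_i\rangle]_\mathbf{k}$; ($\mathsf{J}$) if $i\ne j$, $\#_i\Gamma=(\alpha,\langle\tilde\Delta;\tilde\Gamma\rangle)$, $\#_j\Gamma=(\beta,\mathtt{S})$, $\alpha>\beta$, then $\mathtt{T}\hookrightarrow^{\mathsf{J}}\mathtt{T}[\langle\Delta;(\Gamma[(\alpha,\langle\tilde\Delta;\tilde\Gamma\frown(\beta,\mathtt{S})\rangle)]_i)^{ -j}\rangle]_\mathbf{k}$. Notation: $\mathtt{T}\hookrightarrow^{\mu_1}\circ\hookrightarrow^{\mu_2}\mathtt{S}$ means there is $\mathtt{U}$ with $\mathtt{T}\hookrightarrow^{\mu_1}\mathtt{U}\hookrightarrow^{\mu_2}\mathtt{S}$; $\hookrightarrow^{\mu*}$ means zero or more applications of rule $\mu$. -}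

module Defs where

open import Data.Nat using (ℕ; zero; suc; _<_)
open import Data.Fin using (Fin; toℕ)
open import Data.List using (List; []; _∷_; _++_; [_]; length; lookup)
open import Data.Maybe using (Maybe; just; nothing)
open import Data.Product using (_×_; _,_; ∃; ∃-syntax)
open import Relation.Binary.PropositionalEquality using (_≡_; _≢_)
open import Relation.Binary.Construct.Closure.ReflexiveTransitive using (Star)

PropVar : Set
PropVar = ℕ

-- Modal trees ⟨Δ;Γ⟩: Δ a list of variables, Γ a list of labelled children (α , S), α < ω.
data Tree : Set where
  node : List PropVar → List (ℕ × Tree) → Tree

-- Generic list operations with 0-based natural-number indices
-- (index i here corresponds to index i+1 in the paper).
setN : {A : Set} → List A → ℕ → A → List A
setN []       _       _ = []
setN (_ ∷ xs) zero    y = y ∷ xs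
setN (x ∷ xs) (suc i) y = x ∷ setN xs i y

removeN : {A : Set} → List A → ℕ → List A
removeN []       _       = []
removeN (_ ∷ xs) zero    = xs
removeN (x ∷ xs) (suc i) = x ∷ removeN xs i

swapN : {A : Set} → (xs : List A) → Fin (length xs) → Fin (length xs) → List A
swapN xs i j = setN (setN xs (toℕ i) (lookup xs j)) (toℕ j) (lookup xs i)

-- Positions are lists of child indices (0-based).  T|_k, defined exactly on positions.
mutual
  subtree : Tree → List ℕ → Maybe Tree
  subtree t          []      = just t
  subtree (node Δ Γ) (i ∷ k) = subtreeL Γ i k

  subtreeL : List (ℕ × Tree) → ℕ → List ℕ → Maybe Tree
  subtreeL []            _       _ = nothing
  subtreeL ((_ , s) ∷ Γ) zero    k = subtree s k
  subtreeL (_ ∷ Γ)       (suc i) k = subtreeL Γ i k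

-- T[R]_k (replacement; only used at positions k of T).
mutual
  replace : Tree → List ℕ → Tree → Tree
  replace _          []      r = r
  replace (node Δ Γ) (i ∷ k) r = node Δ (replaceL Γ i k r)

  replaceL : List (ℕ × Tree) → ℕ → List ℕ → Tree → List (ℕ × Tree)
  replaceL []            _       _ _ = []
  replaceL ((a , s) ∷ Γ) zero    k r = (a , replace s k r) ∷ Γ
  replaceL (x ∷ Γ)       (suc i) k r = x ∷ replaceL Γ i k r

data Rule : Set where
  ρ⁺ ρ⁻ σ π⁺ π⁻ 𝟜 λᵣ J : Rule

data Local : Rule → Tree → Tree → Set where
  ρ⁺-step : ∀ {Δ Γ} (i : Fin (length Δ)) →
    Local ρ⁺ (node Δ Γ) (node (lookup Δ i ∷ Δ) Γ)
  ρ⁻-step : ∀ {Δ Γ} (i : Fin (length Δ)) →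
    Local ρ⁻ (node Δ Γ) (node (removeN Δ (toℕ i)) Γ)
  σ-step : ∀ {Δ Γ} (i j : Fin (length Γ)) → i ≢ j →
    Local σ (node Δ Γ) (node Δ (swapN Γ i j))
  π⁺-step : ∀ {Δ Γ} (i : Fin (length Γ)) →
    Local π⁺ (node Δ Γ) (node Δ (lookup Γ i ∷ Γ))
  π⁻-step : ∀ {Δ Γ} (i : Fin (length Γ)) →
    Local π⁻ (node Δ Γ) (node Δ (removeN Γ (toℕ i)))
  𝟜-step : ∀ {Δ Γ Δ' Γ' β S} (i : Fin (length Γ)) (j : Fin (length Γ')) →
    lookup Γ i ≡ (β , node Δ' Γ') → lookup Γ' j ≡ (β , S) →
    Local 𝟜 (node Δ Γ) (node Δ (setN Γ (toℕ i) (β , S)))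
  λ-step : ∀ {Δ Γ α β S} (i : Fin (length Γ)) →
    lookup Γ i ≡ (α , S) → β < α →
    Local λᵣ (node Δ Γ) (node Δ (setN Γ (toℕ i) (β , S)))
  J-step : ∀ {Δ Γ α β Δ' Γ' S} (i j : Fin (length Γ)) → i ≢ j →
    lookup Γ i ≡ (α , node Δ' Γ') → lookup Γ j ≡ (β , S) → β < α →
    Local J (node Δ Γ)
      (node Δ (removeN (setN Γ (toℕ i) (α , node Δ' (Γ' ++ [ (β , S) ]))) (toℕ j)))

_↪[_]_ : Tree → Rule → Tree → Set
T ↪[ μ ] S = ∃[ k ] ∃[ Δ ] ∃[ Γ ] ∃[ R ]
  (subtree T k ≡ just (node Δ Γ) × Local μ (node Δ Γ) R × S ≡ replace T k R)

_↪σ*_ : Tree → Tree → Set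
_↪σ*_ = Star (λ T S → T ↪[ σ ] S)

{-# OPTIONS --safe #-}
-- A σ-step only reorders the children of one node, so T and U are related by the
-- congruence ∼ "children permuted, at every node".  Every rule other than σ is
-- insensitive to the order of children: a step U ↪μ S can be replayed at the
-- corresponding position of T, giving T ↪μ S' with S ∼ S', and ∼-related trees are
-- connected by σ-steps.  For J the two chosen children are moved to the front of the
-- list, where the step and its replay visibly agree up to permutation.
module Submission where

open import Defs
open import Data.Product using (_×_; ∃-syntax)
open import Relation.Binary.PropositionalEquality using (_≢_)

open import Data.Empty using (⊥-elim)
open import Data.Fin using (Fin; zero; suc; toℕ)
open import Data.Fin.Properties using (suc-injective)
open import Data.List using (List; []; _∷_; _++_; [_]; length; lookup)
open import Data.List.Relation.Unary.Any using (here; index)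
open import Data.List.Relation.Unary.Any.Properties using (lookup-index)
open import Data.List.Relation.Binary.Pointwise using (Pointwise; []; _∷_; ++⁺)
open import Data.List.Relation.Binary.Permutation.Propositional as ↭
  using (_↭_; ↭-refl; ↭-sym; ↭-trans; prep; swap)
open import Data.List.Relation.Binary.Permutation.Propositional.Properties
  using (∈-resp-↭; drop-∷; shifts; ++⁺ʳ)
open import Data.Maybe using (just)
open import Data.Nat using (ℕ; zero; suc)
open import Data.Product using (Σ; _,_)
open import Data.Product.Relation.Binary.Pointwise.NonDependent using () renaming (Pointwise to _×ᴿ_)
open import Function using (_∘_)
open import Relation.Binary.PropositionalEquality using (_≡_; refl; sym; trans; cong; subst; subst₂)
open import Relation.Binary.Construct.Closure.ReflexiveTransitive using (ε; _◅_; _◅◅_; gmap)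

module _ {A : Set} where

  ↭-lookup-removeN : (xs : List A) (i : Fin (length xs)) → xs ↭ lookup xs i ∷ removeN xs (toℕ i)
  ↭-lookup-removeN (x ∷ xs) zero    = ↭-refl
  ↭-lookup-removeN (x ∷ xs) (suc i) =
    ↭-trans (prep x (↭-lookup-removeN xs i)) (swap x (lookup xs i) ↭-refl)

  setN-↭ : (xs : List A) (i : Fin (length xs)) (z : A) → setN xs (toℕ i) z ↭ z ∷ removeN xs (toℕ i)
  setN-↭ (x ∷ xs) zero    z = ↭-refl
  setN-↭ (x ∷ xs) (suc i) z = ↭-trans (prep x (setN-↭ xs i z)) (swap x z ↭-refl)

  lookup∷setN-↭ : (x : A) (xs : List A) (i : Fin (length xs)) → lookup xs i ∷ setN xs (toℕ i) x ↭ x ∷ xs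
  lookup∷setN-↭ x xs i =
    ↭-trans (prep (lookup xs i) (setN-↭ xs i x))
      (↭-trans (swap (lookup xs i) x ↭-refl) (prep x (↭-sym (↭-lookup-removeN xs i))))

  swapN-↭ : (xs : List A) (i j : Fin (length xs)) → swapN xs i j ↭ xs
  swapN-↭ (x ∷ xs) zero    zero    = ↭-refl
  swapN-↭ (x ∷ xs) zero    (suc j) = lookup∷setN-↭ x xs j
  swapN-↭ (x ∷ xs) (suc i) zero    = lookup∷setN-↭ x xs i
  swapN-↭ (x ∷ xs) (suc i) (suc j) = prep x (swapN-↭ xs i j)

  removeN-setN-↭ : (xs : List A) (i j : Fin (length xs)) → i ≢ j →
    ∃[ ys ] (xs ↭ lookup xs i ∷ lookup xs j ∷ ys ×
             (∀ z → removeN (setN xs (toℕ i) z) (toℕ j) ↭ z ∷ ys))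
  removeN-setN-↭ (x ∷ xs) zero    zero    i≢j = ⊥-elim (i≢j refl)
  removeN-setN-↭ (x ∷ xs) zero    (suc j) _   =
    removeN xs (toℕ j) , prep x (↭-lookup-removeN xs j) , λ _ → ↭-refl
  removeN-setN-↭ (x ∷ xs) (suc i) zero    _   =
    removeN xs (toℕ i) , ↭-trans (prep x (↭-lookup-removeN xs i)) (swap x _ ↭-refl) , setN-↭ xs i
  removeN-setN-↭ (x ∷ xs) (suc i) (suc j) i≢j with removeN-setN-↭ xs i j (i≢j ∘ cong suc)
  ... | ys , xs↭ , result↭ =
    x ∷ ys , ↭-trans (prep x xs↭) (shifts [ x ] (_ ∷ _ ∷ [])) ,
    λ z → ↭-trans (prep x (result↭ z)) (swap x z ↭-refl)

  removeN-setN-↭-punchIn : (xs : List A) (i : Fin (length xs)) (k : Fin (length (removeN xs (toℕ i)))) →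
    ∃[ j ] (i ≢ j × lookup xs j ≡ lookup (removeN xs (toℕ i)) k ×
            (∀ z → removeN (setN xs (toℕ i) z) (toℕ j) ↭ z ∷ removeN (removeN xs (toℕ i)) (toℕ k)))
  removeN-setN-↭-punchIn (x ∷ xs) zero    k       = suc k , (λ ()) , refl , λ _ → ↭-refl
  removeN-setN-↭-punchIn (x ∷ xs) (suc i) zero    = zero , (λ ()) , refl , setN-↭ xs i
  removeN-setN-↭-punchIn (x ∷ xs) (suc i) (suc k) with removeN-setN-↭-punchIn xs i k
  ... | j , i≢j , xs[j] , result↭ =
    suc j , i≢j ∘ suc-injective , xs[j] , λ z → ↭-trans (prep x (result↭ z)) (swap x z ↭-refl)

module PermutationUpTo {A : Set} (R : A → A → Set) where

  -- Unlike Permutation.Homogeneous, R is used exactly once per element, so the lemmas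
  -- below need no property of R (for trees, R mentions the relation being defined).
  infix 4 _≋↭_
  _≋↭_ : List A → List A → Set
  xs ≋↭ ys = ∃[ zs ] (Pointwise R xs zs × zs ↭ ys)

  Pointwise⇒≋↭ : ∀ {xs ys} → Pointwise R xs ys → xs ≋↭ ys
  Pointwise⇒≋↭ rs = _ , rs , ↭-refl

  ↭-Pointwise⇒≋↭ : ∀ {xs ys zs} → xs ↭ ys → Pointwise R ys zs → xs ≋↭ zs
  ↭-Pointwise⇒≋↭ ↭.refl       rs = _ , rs , ↭-refl
  ↭-Pointwise⇒≋↭ (prep x p) (r ∷ rs) with ↭-Pointwise⇒≋↭ p rs
  ... | _ , rs′ , p′ = _ , r ∷ rs′ , prep _ p′
  ↭-Pointwise⇒≋↭ (swap x y p) (r ∷ r′ ∷ rs) with ↭-Pointwise⇒≋↭ p rs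
  ... | _ , rs′ , p′ = _ , r′ ∷ r ∷ rs′ , swap _ _ p′
  ↭-Pointwise⇒≋↭ (↭.trans p q) rs with ↭-Pointwise⇒≋↭ q rs
  ... | _ , rs₁ , q′ with ↭-Pointwise⇒≋↭ p rs₁
  ... | _ , rs₂ , p′ = _ , rs₂ , ↭-trans p′ q′

  ↭-≋↭-trans : ∀ {xs ys zs} → xs ↭ ys → ys ≋↭ zs → xs ≋↭ zs
  ↭-≋↭-trans p (_ , rs , q) with ↭-Pointwise⇒≋↭ p rs
  ... | _ , rs′ , p′ = _ , rs′ , ↭-trans p′ q

  ≋↭-↭-trans : ∀ {xs ys zs} → xs ≋↭ ys → ys ↭ zs → xs ≋↭ zs
  ≋↭-↭-trans (_ , rs , p) q = _ , rs , ↭-trans p q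

  ≋↭-∷ : ∀ {x y xs ys} → R x y → xs ≋↭ ys → x ∷ xs ≋↭ y ∷ ys
  ≋↭-∷ r (_ , rs , p) = _ , r ∷ rs , prep _ p

  ≋↭-∷ʳ : ∀ {x y xs ys} → xs ≋↭ ys → R x y → xs ++ [ x ] ≋↭ ys ++ [ y ]
  ≋↭-∷ʳ (_ , rs , p) r = _ , ++⁺ rs (r ∷ []) , ++⁺ʳ _ p

  ≋↭-uncons : ∀ {x xs ys} → x ∷ xs ≋↭ ys →
    ∃[ i ] ∃[ y ] (lookup ys i ≡ y × R x y × xs ≋↭ removeN ys (toℕ i))
  ≋↭-uncons {ys = ys} (z ∷ zs , r ∷ rs , p) =
    i , z , sym ys[i] , r , zs , rs , drop-∷ (↭-trans p ys↭)
    where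
      z∈ys = ∈-resp-↭ p (here refl)
      i    = index z∈ys
      ys[i] : z ≡ lookup ys i
      ys[i] = lookup-index z∈ys
      ys↭ : ys ↭ z ∷ removeN ys (toℕ i)
      ys↭ = subst (λ w → ys ↭ w ∷ removeN ys (toℕ i)) (sym ys[i]) (↭-lookup-removeN ys i)

  ≋↭-lookup : ∀ {x xs ys} → xs ≋↭ ys → (i : Fin (length xs)) → lookup xs i ≡ x →
    ∃[ i′ ] ∃[ y ] (lookup ys i′ ≡ y × R x y × removeN xs (toℕ i) ≋↭ removeN ys (toℕ i′))
  ≋↭-lookup {xs = xs} p i refl = ≋↭-uncons (↭-≋↭-trans (↭-sym (↭-lookup-removeN xs i)) p)

  ≋↭-setN : ∀ xs ys (i : Fin (length xs)) (i′ : Fin (length ys)) {z z′} →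
    removeN xs (toℕ i) ≋↭ removeN ys (toℕ i′) → R z z′ → setN xs (toℕ i) z ≋↭ setN ys (toℕ i′) z′
  ≋↭-setN xs ys i i′ p r =
    ↭-≋↭-trans (setN-↭ xs i _) (≋↭-↭-trans (≋↭-∷ r p) (↭-sym (setN-↭ ys i′ _)))

mutual
  infix 4 _∼_ _∼ᶜ_

  data _∼_ : Tree → Tree → Set where
    node∼ : ∀ {Δ Γ Γ′} → PermutationUpTo._≋↭_ _∼ᶜ_ Γ Γ′ → node Δ Γ ∼ node Δ Γ′

  _∼ᶜ_ : ℕ × Tree → ℕ × Tree → Set
  _∼ᶜ_ = _≡_ ×ᴿ _∼_

open PermutationUpTo _∼ᶜ_

mutual
  ∼-refl : (T : Tree) → T ∼ T
  ∼-refl (node Δ Γ) = node∼ (Pointwise⇒≋↭ (∼ᶜ-refls Γ))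

  ∼ᶜ-refls : (Γ : List (ℕ × Tree)) → Pointwise _∼ᶜ_ Γ Γ
  ∼ᶜ-refls []            = []
  ∼ᶜ-refls ((α , S) ∷ Γ) = (refl , ∼-refl S) ∷ ∼ᶜ-refls Γ

mutual
  replace-∼ : ∀ T k {R R′} → R ∼ R′ → replace T k R ∼ replace T k R′
  replace-∼ T          []      r = r
  replace-∼ (node Δ Γ) (i ∷ k) r = node∼ (Pointwise⇒≋↭ (replaceL-∼ Γ i k r))

  replaceL-∼ : ∀ Γ i k {R R′} → R ∼ R′ → Pointwise _∼ᶜ_ (replaceL Γ i k R) (replaceL Γ i k R′)
  replaceL-∼ []            _       _ _ = []
  replaceL-∼ ((α , S) ∷ Γ) zero    k r = (refl , replace-∼ S k r) ∷ ∼ᶜ-refls Γ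
  replaceL-∼ ((α , S) ∷ Γ) (suc i) k r = (refl , ∼-refl S) ∷ replaceL-∼ Γ i k r

mutual
  replace-subtree : ∀ T k {N} → subtree T k ≡ just N → replace T k N ≡ T
  replace-subtree T          []      refl = refl
  replace-subtree (node Δ Γ) (i ∷ k) T|k  = cong (node Δ) (replaceL-subtreeL Γ i k T|k)

  replaceL-subtreeL : ∀ Γ i k {N} → subtreeL Γ i k ≡ just N → replaceL Γ i k N ≡ Γ
  replaceL-subtreeL []            _       _ ()
  replaceL-subtreeL ((α , S) ∷ Γ) zero    k S|k = cong (λ S′ → (α , S′) ∷ Γ) (replace-subtree S k S|k)
  replaceL-subtreeL (c ∷ Γ)       (suc i) k Γ|k = cong (c ∷_) (replaceL-subtreeL Γ i k Γ|k)

subtreeL-index : ∀ Γ n k {N} → subtreeL Γ n k ≡ just N → Σ (Fin (length Γ)) λ i → toℕ i ≡ n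
subtreeL-index []      _       _ ()
subtreeL-index (_ ∷ Γ) zero    _ _   = zero , refl
subtreeL-index (_ ∷ Γ) (suc n) k Γ|k with subtreeL-index Γ n k Γ|k
... | i , refl = suc i , refl

subtreeL-lookup : ∀ Γ (i : Fin (length Γ)) k {α C} → lookup Γ i ≡ (α , C) →
  subtreeL Γ (toℕ i) k ≡ subtree C k
subtreeL-lookup (_ ∷ Γ) zero    k refl = refl
subtreeL-lookup (_ ∷ Γ) (suc i) k Γ[i] = subtreeL-lookup Γ i k Γ[i]

replaceL-lookup : ∀ Γ (i : Fin (length Γ)) k R {α C} → lookup Γ i ≡ (α , C) →
  replaceL Γ (toℕ i) k R ≡ setN Γ (toℕ i) (α , replace C k R)
replaceL-lookup (_ ∷ Γ) zero    k R refl = refl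
replaceL-lookup (c ∷ Γ) (suc i) k R Γ[i] = cong (c ∷_) (replaceL-lookup Γ i k R Γ[i])

↪σ⇒∼ : ∀ {T U} → T ↪[ σ ] U → U ∼ T
↪σ⇒∼ {T} (k , Δ , Γ , _ , T|k , σ-step i j _ , refl) =
  subst (replace T k (node Δ (swapN Γ i j)) ∼_) (replace-subtree T k T|k)
    (replace-∼ T k (node∼ (↭-Pointwise⇒≋↭ (swapN-↭ Γ i j) (∼ᶜ-refls Γ))))

addChild : ℕ × Tree → Tree → Tree
addChild c (node Δ Γ) = node Δ (c ∷ Γ)

↪σ-addChild : ∀ c {T T′} → T ↪[ σ ] T′ → addChild c T ↪[ σ ] addChild c T′
↪σ-addChild c {node Δ Γ} ([] , _ , _ , _ , refl , σ-step i j i≢j , refl) =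
  [] , _ , _ , _ , refl , σ-step (suc i) (suc j) (i≢j ∘ suc-injective) , refl
↪σ-addChild c {node Δ Γ} (n ∷ k , _ , _ , _ , Γ|nk , step , refl) =
  suc n ∷ k , _ , _ , _ , Γ|nk , step , refl

↪-child : ∀ {μ} Δ α Γ {S S′} → S ↪[ μ ] S′ → node Δ ((α , S) ∷ Γ) ↪[ μ ] node Δ ((α , S′) ∷ Γ)
↪-child Δ α Γ (k , _ , _ , _ , S|k , step , refl) = zero ∷ k , _ , _ , _ , S|k , step , refl

↪σ-swap : ∀ Δ c d Γ → node Δ (c ∷ d ∷ Γ) ↪[ σ ] node Δ (d ∷ c ∷ Γ)
↪σ-swap Δ c d Γ = [] , _ , _ , _ , refl , σ-step zero (suc zero) (λ ()) , refl

↭⇒↪σ* : ∀ {Δ Γ Γ′} → Γ ↭ Γ′ → node Δ Γ ↪σ* node Δ Γ′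
↭⇒↪σ* ↭.refl         = ε
↭⇒↪σ* (prep c p)     = gmap (addChild c) (↪σ-addChild c) (↭⇒↪σ* p)
↭⇒↪σ* {Δ} (swap c d p) =
  ↪σ-swap Δ c d _ ◅ gmap (addChild d) (↪σ-addChild d) (gmap (addChild c) (↪σ-addChild c) (↭⇒↪σ* p))
↭⇒↪σ* (↭.trans p q)  = ↭⇒↪σ* p ◅◅ ↭⇒↪σ* q

mutual
  ∼⇒↪σ* : ∀ {S S′} → S ∼ S′ → S′ ↪σ* S
  ∼⇒↪σ* (node∼ (_ , rs , p)) = ↭⇒↪σ* (↭-sym p) ◅◅ Pointwise⇒↪σ* rs

  Pointwise⇒↪σ* : ∀ {Δ Γ Γ′} → Pointwise _∼ᶜ_ Γ Γ′ → node Δ Γ′ ↪σ* node Δ Γ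
  Pointwise⇒↪σ* [] = ε
  Pointwise⇒↪σ* {Δ} {(α , S) ∷ Γ} {(_ , S′) ∷ Γ′} ((refl , S∼S′) ∷ rs) =
    gmap (λ C → node Δ ((α , C) ∷ Γ′)) (↪-child Δ α Γ′) (∼⇒↪σ* S∼S′) ◅◅
    gmap (addChild (α , S)) (↪σ-addChild (α , S)) (Pointwise⇒↪σ* rs)

∼-subtree : ∀ {U T N} → U ∼ T → (k : List ℕ) → subtree U k ≡ just N →
  ∃[ k′ ] ∃[ N′ ] (subtree T k′ ≡ just N′ × N ∼ N′ ×
                   (∀ {R R′} → R ∼ R′ → replace U k R ∼ replace T k′ R′))
∼-subtree U∼T [] refl = [] , _ , refl , U∼T , λ R∼R′ → R∼R′
∼-subtree (node∼ {Γ = Γ} {Γ′} p) (n ∷ k) U|k with subtreeL-index Γ n k U|k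
... | i , refl with ≋↭-lookup p i refl
... | i′ , (_ , _) , Γ′[i′] , (refl , C∼C′) , rest
    with ∼-subtree C∼C′ k (trans (sym (subtreeL-lookup Γ i k refl)) U|k)
... | k′ , N′ , C′|k′ , N∼N′ , replace∼ =
  toℕ i′ ∷ k′ , N′ , trans (subtreeL-lookup Γ′ i′ k′ Γ′[i′]) C′|k′ , N∼N′ ,
  λ R∼R′ → node∼ (subst₂ _≋↭_ (sym (replaceL-lookup Γ i k _ refl))
                                (sym (replaceL-lookup Γ′ i′ k′ _ Γ′[i′]))
                    (≋↭-setN Γ Γ′ i i′ rest (refl , replace∼ R∼R′)))

Local-∼ : ∀ {μ Δ Γ Γ′ R} → μ ≢ σ → Γ ≋↭ Γ′ → Local μ (node Δ Γ) R →
  ∃[ R′ ] (Local μ (node Δ Γ′) R′ × R ∼ R′)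
Local-∼ _ p (ρ⁺-step i) = _ , ρ⁺-step i , node∼ p
Local-∼ _ p (ρ⁻-step i) = _ , ρ⁻-step i , node∼ p
Local-∼ μ≢σ _ (σ-step _ _ _) = ⊥-elim (μ≢σ refl)
Local-∼ _ p (π⁺-step i) with ≋↭-lookup p i refl
... | i′ , _ , refl , r , _ = _ , π⁺-step i′ , node∼ (≋↭-∷ r p)
Local-∼ _ p (π⁻-step i) with ≋↭-lookup p i refl
... | i′ , _ , _ , _ , rest = _ , π⁻-step i′ , node∼ rest
Local-∼ {Γ = Γ} {Γ′} _ p (λ-step i Γ[i] β<α) with ≋↭-lookup p i Γ[i]
... | i′ , (_ , _) , Γ′[i′] , (refl , S∼S′) , rest =
  _ , λ-step i′ Γ′[i′] β<α , node∼ (≋↭-setN Γ Γ′ i i′ rest (refl , S∼S′))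
Local-∼ {Γ = Γ} {Γ′} _ p (𝟜-step i j Γ[i] Γᵢ[j]) with ≋↭-lookup p i Γ[i]
... | i′ , (_ , _) , Γ′[i′] , (refl , node∼ q) , rest with ≋↭-lookup q j Γᵢ[j]
... | j′ , (_ , _) , Γ′ᵢ[j′] , (refl , S∼S′) , _ =
  _ , 𝟜-step i′ j′ Γ′[i′] Γ′ᵢ[j′] , node∼ (≋↭-setN Γ Γ′ i i′ rest (refl , S∼S′))
Local-∼ {Γ = Γ} {Γ′} _ p (J-step i j i≢j Γ[i] Γ[j] β<α) with removeN-setN-↭ Γ i j i≢j
... | ys , Γ↭ , result↭
    with ≋↭-uncons (↭-≋↭-trans (↭-sym (subst₂ (λ x y → Γ ↭ x ∷ y ∷ ys) Γ[i] Γ[j] Γ↭)) p)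
... | i′ , (_ , _) , Γ′[i′] , (refl , node∼ q) , p₁ with ≋↭-uncons p₁
... | k , (_ , _) , Γ′₋[k] , (refl , S∼S′) , rest with removeN-setN-↭-punchIn Γ′ i′ k
... | j′ , i′≢j′ , Γ′[j′] , result′↭ =
  _ , J-step i′ j′ i′≢j′ Γ′[i′] (trans Γ′[j′] Γ′₋[k]) β<α ,
  node∼ (↭-≋↭-trans (result↭ _)
          (≋↭-↭-trans (≋↭-∷ (refl , node∼ (≋↭-∷ʳ q (refl , S∼S′))) rest) (↭-sym (result′↭ _))))

mainTheorem15 : (μ : Rule) → μ ≢ σ → (T S : Tree) →
    (∃[ U ] (T ↪[ σ ] U × U ↪[ μ ] S)) →
    ∃[ U ] (T ↪[ μ ] U × U ↪σ* S)
mainTheorem15 μ μ≢σ T S (U , T↪U , k , Δ , Γ , R , U|k , step , refl)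
  with ∼-subtree (↪σ⇒∼ T↪U) k U|k
... | k′ , _ , T|k′ , node∼ p , replace∼ with Local-∼ μ≢σ p step
... | R′ , step′ , R∼R′ =
  replace T k′ R′ , (k′ , _ , _ , R′ , T|k′ , step′ , refl) , ∼⇒↪σ* (replace∼ R∼R′)
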